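{- If, for all $n\ge 0$, $P_n=G^n$, or if, for all $n\ge0$, $P_n=U(F^n)$, then $P_{n+4}+F^4P_n+FP_{n+1}=0$ for all $n\ge 0$.
   Context: $\mathbb{Z}/2[r]$ is the polynomial ring over the field with two elements; $F=r(r+1)^3$, $G=r^3(r+1)$. $\mathbb{Z}/2[r]$ is a free $\mathbb{Z}/2[G]$-module with basis $1,r,r^2,r^3$. $U:\mathbb{Z}/2[r]\to\mathbb{Z}/2[r]$ is $U\big(\sum_{i=0}^3 g_i(G)r^i\big)=\sum_{i=0}^3 g_i(F)U(r^i)$ with $U(1)=1$, $U(r)=r$, $U(r^2)=r^2$, $U(r^3)=r^3+r^2+r$. -}

module Defs where

open import Data.Bool using (Bool; true; false; _xor_; if_then_else_)
open import Data.List using (List; []; _∷_)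
open import Data.List.Relation.Unary.All using (All)
open import Data.Nat using (ℕ; zero; suc)
open import Relation.Binary.PropositionalEquality using (_≡_)

-- Polynomials in 𝔽₂[r], as coefficient lists, lowest degree first.
-- Trailing zero coefficients are allowed; equality is "difference is zero".
Poly : Set
Poly = List Bool

infixl 6 _⊕_
infixl 7 _⊗_
infixr 8 _^_
infix 4 _≈_

_⊕_ : Poly → Poly → Poly
[]      ⊕ q       = q
(a ∷ p) ⊕ []      = a ∷ p
(a ∷ p) ⊕ (b ∷ q) = (a xor b) ∷ (p ⊕ q)

_⊗_ : Poly → Poly → Poly
[]      ⊗ q = []
(a ∷ p) ⊗ q = (if a then q else []) ⊕ (false ∷ (p ⊗ q))

one : Poly
one = true ∷ []

_^_ : Poly → ℕ → Poly
p ^ zero  = one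
p ^ suc n = p ⊗ (p ^ n)

IsZero : Poly → Set
IsZero p = All (_≡ false) p

_≈_ : Poly → Poly → Set
p ≈ q = IsZero (p ⊕ q)

-- F = r(r+1)^3 = r + r^2 + r^3 + r^4
F : Poly
F = false ∷ true ∷ true ∷ true ∷ true ∷ []

-- G = r^3(r+1) = r^3 + r^4
G : Poly
G = false ∷ false ∷ false ∷ true ∷ true ∷ []

-- A "digit": an element d0 + d1 r + d2 r^2 + d3 r^3 of the span of the
-- basis 1, r, r^2, r^3 with 𝔽₂ coefficients.
data Digit : Set where
  dig : Bool → Bool → Bool → Bool → Digit

-- Expansion  p = Σ_k D_k G^k  (D_k digits), which is exactly the
-- decomposition p = Σ_{i=0}^{3} g_i(G) r^i  (g_i = Σ_k (D_k)_i X^k).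
-- Multiplication of an expansion by r, using r^4 = G + r^3;
-- the Bool is the carry into the constant term of the current digit.
mulR : Bool → List Digit → List Digit
mulR c []                   = if c then dig true false false false ∷ [] else []
mulR c (dig a b e d ∷ ds)   = dig c a b (e xor d) ∷ mulR d ds

addConst : Bool → List Digit → List Digit
addConst a []                  = dig a false false false ∷ []
addConst a (dig x b e d ∷ ds)  = dig (a xor x) b e d ∷ ds

-- G-adic expansion of a polynomial (Horner: p = a + r p')
expand : Poly → List Digit
expand []      = []
expand (a ∷ p) = addConst a (mulR false (expand p))

Udig : Digit → Poly
Udig (dig d0 d1 d2 d3) = d0 ∷ (d1 xor d3) ∷ (d2 xor d3) ∷ d3 ∷ []

Uexp : List Digit → Poly
Uexp []       = []
Uexp (d ∷ ds) = Udig d ⊕ F ⊗ Uexp ds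

-- U (Σ g_i(G) r^i) = Σ g_i(F) U(r^i)
U : Poly → Poly
U p = Uexp (expand p)

{-# OPTIONS --safe #-}
module Submission where

-- In 𝔽₂[r] one has F ⊕ G = r(r+1)((r+1)² ⊕ r²) = r(r+1), hence
-- F⁴ ⊕ G⁴ = (F ⊕ G)⁴ = F G.  Multiplying this identity by G^n gives the
-- recurrence for G^n.  For U(F^n), write F^(n+4) = G⁴ F^n ⊕ G F^(n+1) and apply U:
-- U is additive and U(G x) = F U(x), because multiplying Σ g_i(G) r^i by G
-- multiplies every g_i by X, i.e. shifts the G-adic digits.

open import Defs
open import Algebra.Bundles using (CommutativeSemigroup; CommutativeRing)
import Algebra.Properties.CommutativeSemigroup as CommutativeSemigroupProperties
open import Data.Bool using (Bool; true; false; _xor_; if_then_else_)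
open import Data.Bool.Properties
  using (xor-comm; xor-assoc; xor-identityʳ; xor-same; xor-∧-commutativeRing)
  renaming (_≟_ to _≟ᴮ_)
open import Data.List using (List; []; _∷_; [_])
open import Data.List.Relation.Unary.All using ([]; _∷_; all?)
open import Data.Nat using (ℕ; zero; suc; _+_)
open import Data.Sum using (_⊎_; inj₁; inj₂)
open import Level using (0ℓ)
open import Relation.Binary.Bundles using (Setoid)
import Relation.Binary.Reasoning.Setoid as SetoidReasoning
open import Relation.Binary.PropositionalEquality
  using (_≡_; refl; sym; trans; cong; cong₂; subst; subst₂; module ≡-Reasoning)
open import Relation.Binary.PropositionalEquality.Algebra using (isMagma)
open import Relation.Nullary.Decidable using (Dec; True; toWitness)

open CommutativeSemigroupProperties
  (CommutativeRing.+-commutativeSemigroup xor-∧-commutativeRing)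
  using () renaming (interchange to xor-interchange)

⊕-identityʳ : ∀ p → p ⊕ [] ≡ p
⊕-identityʳ []      = refl
⊕-identityʳ (a ∷ p) = refl

⊕-comm : ∀ p q → p ⊕ q ≡ q ⊕ p
⊕-comm []      q       = sym (⊕-identityʳ q)
⊕-comm (a ∷ p) []      = refl
⊕-comm (a ∷ p) (b ∷ q) = cong₂ _∷_ (xor-comm a b) (⊕-comm p q)

⊕-assoc : ∀ p q s → (p ⊕ q) ⊕ s ≡ p ⊕ (q ⊕ s)
⊕-assoc []      q       s       = refl
⊕-assoc (a ∷ p) []      s       = refl
⊕-assoc (a ∷ p) (b ∷ q) []      = refl
⊕-assoc (a ∷ p) (b ∷ q) (c ∷ s) = cong₂ _∷_ (xor-assoc a b c) (⊕-assoc p q s)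

⊕-commutativeSemigroup : CommutativeSemigroup 0ℓ 0ℓ
⊕-commutativeSemigroup = record
  { isCommutativeSemigroup = record
    { isSemigroup = record { isMagma = isMagma _⊕_ ; assoc = ⊕-assoc }
    ; comm        = ⊕-comm
    }
  }

open CommutativeSemigroupProperties ⊕-commutativeSemigroup
  using () renaming (interchange to ⊕-interchange)

⊕-same : ∀ p → IsZero (p ⊕ p)
⊕-same []      = []
⊕-same (a ∷ p) = xor-same a ∷ ⊕-same p

IsZero-⊕ : ∀ {p q} → IsZero p → IsZero q → IsZero (p ⊕ q)
IsZero-⊕ []          zq          = zq
IsZero-⊕ (e ∷ zp)    []          = e ∷ zp
IsZero-⊕ (refl ∷ zp) (refl ∷ zq) = refl ∷ IsZero-⊕ zp zq

IsZero-cancelʳ : ∀ p {z} → IsZero z → IsZero (p ⊕ z) → IsZero p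
IsZero-cancelʳ []      _           _        = []
IsZero-cancelʳ (a ∷ p) []          zp       = zp
IsZero-cancelʳ (a ∷ p) (refl ∷ zz) (e ∷ zp) =
  trans (sym (xor-identityʳ a)) e ∷ IsZero-cancelʳ p zz zp

infix 4 _≋_

-- _≈_ computes, so Agda cannot recover p and q from p ≈ q; the record can.
record _≋_ (p q : Poly) : Set where
  constructor ⟨_⟩
  field ≋⇒≈ : p ≈ q

open _≋_

≋-refl : ∀ {p} → p ≋ p
≋-refl {p} = ⟨ ⊕-same p ⟩

≋-reflexive : ∀ {p q} → p ≡ q → p ≋ q
≋-reflexive refl = ≋-refl

≋-sym : ∀ {p q} → p ≋ q → q ≋ p
≋-sym {p} {q} ⟨ h ⟩ = ⟨ subst IsZero (⊕-comm p q) h ⟩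

≋-trans : ∀ {p q s} → p ≋ q → q ≋ s → p ≋ s
≋-trans {p} {q} {s} ⟨ h₁ ⟩ ⟨ h₂ ⟩ =
  ⟨ IsZero-cancelʳ (p ⊕ s) (⊕-same q) (subst IsZero regroup (IsZero-⊕ h₁ h₂)) ⟩
  where
  regroup : (p ⊕ q) ⊕ (q ⊕ s) ≡ (p ⊕ s) ⊕ (q ⊕ q)
  regroup = trans (cong ((p ⊕ q) ⊕_) (⊕-comm q s)) (⊕-interchange p q s q)

≋-setoid : Setoid 0ℓ 0ℓ
≋-setoid = record
  { Carrier       = Poly
  ; _≈_           = _≋_
  ; isEquivalence = record { refl = ≋-refl ; sym = ≋-sym ; trans = ≋-trans }
  }

⊕-cong : ∀ {p p′ q q′} → p ≋ p′ → q ≋ q′ → p ⊕ q ≋ p′ ⊕ q′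
⊕-cong {p} {p′} {q} {q′} ⟨ h₁ ⟩ ⟨ h₂ ⟩ =
  ⟨ subst IsZero (⊕-interchange p p′ q q′) (IsZero-⊕ h₁ h₂) ⟩

⊕-congˡ : ∀ {p q q′} → q ≋ q′ → p ⊕ q ≋ p ⊕ q′
⊕-congˡ = ⊕-cong ≋-refl

IsZero-resp-≋ : ∀ {p q} → p ≋ q → IsZero q → IsZero p
IsZero-resp-≋ {p} ⟨ h ⟩ zq = IsZero-cancelʳ p zq h

IsZero⇒≋ : ∀ {p q} → IsZero p → IsZero q → p ≋ q
IsZero⇒≋ zp zq = ⟨ IsZero-⊕ zp zq ⟩

⊕-identityˡ-IsZero : ∀ {z} p → IsZero z → z ⊕ p ≋ p
⊕-identityˡ-IsZero {z} p zz = ⟨ subst IsZero (sym (⊕-assoc z p p)) (IsZero-⊕ zz (⊕-same p)) ⟩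

∷-cong : ∀ {p q} a → p ≋ q → a ∷ p ≋ a ∷ q
∷-cong a ⟨ h ⟩ = ⟨ xor-same a ∷ h ⟩

infixr 7 _·_

_·_ : Bool → Poly → Poly
a · q = if a then q else []

·-distribʳ-xor : ∀ a b q → (a xor b) · q ≋ a · q ⊕ b · q
·-distribʳ-xor false _     q = ≋-refl
·-distribʳ-xor true  false q = ≋-reflexive (sym (⊕-identityʳ q))
·-distribʳ-xor true  true  q = ⟨ ⊕-same q ⟩

·-distribˡ-⊕ : ∀ a p q → a · (p ⊕ q) ≡ a · p ⊕ a · q
·-distribˡ-⊕ false _ _ = refl
·-distribˡ-⊕ true  _ _ = refl

·-⊗ : ∀ a q s → (a · q) ⊗ s ≡ a · (q ⊗ s)
·-⊗ false _ _ = refl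
·-⊗ true  _ _ = refl

IsZero-· : ∀ a {z} → IsZero z → IsZero (a · z)
IsZero-· false _  = []
IsZero-· true  zz = zz

⊗-distribʳ-⊕ : ∀ p p′ q → (p ⊕ p′) ⊗ q ≋ p ⊗ q ⊕ p′ ⊗ q
⊗-distribʳ-⊕ []      p′       q = ≋-refl
⊗-distribʳ-⊕ (a ∷ p) []       q = ≋-reflexive (sym (⊕-identityʳ _))
⊗-distribʳ-⊕ (a ∷ p) (b ∷ p′) q =
  ≋-trans (⊕-cong (·-distribʳ-xor a b q) (∷-cong false (⊗-distribʳ-⊕ p p′ q)))
          (≋-reflexive (⊕-interchange (a · q) (b · q) (false ∷ p ⊗ q) (false ∷ p′ ⊗ q)))

⊗-distribˡ-⊕ : ∀ p q q′ → p ⊗ (q ⊕ q′) ≋ p ⊗ q ⊕ p ⊗ q′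
⊗-distribˡ-⊕ []      q q′ = ≋-refl
⊗-distribˡ-⊕ (a ∷ p) q q′ =
  ≋-trans (⊕-cong (≋-reflexive (·-distribˡ-⊕ a q q′)) (∷-cong false (⊗-distribˡ-⊕ p q q′)))
          (≋-reflexive (⊕-interchange (a · q) (a · q′) (false ∷ p ⊗ q) (false ∷ p ⊗ q′)))

IsZero-⊗ˡ : ∀ {z} q → IsZero z → IsZero (z ⊗ q)
IsZero-⊗ˡ q []          = []
IsZero-⊗ˡ q (refl ∷ zz) = refl ∷ IsZero-⊗ˡ q zz

IsZero-⊗ʳ : ∀ p {z} → IsZero z → IsZero (p ⊗ z)
IsZero-⊗ʳ []      zz = []
IsZero-⊗ʳ (a ∷ p) zz = IsZero-⊕ (IsZero-· a zz) (refl ∷ IsZero-⊗ʳ p zz)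

additive-cong : (f : Poly → Poly) →
  (∀ p q → f (p ⊕ q) ≋ f p ⊕ f q) → (∀ {z} → IsZero z → IsZero (f z)) →
  ∀ {p q} → p ≋ q → f p ≋ f q
additive-cong f f-⊕ f-zero {p} {q} ⟨ h ⟩ = ⟨ IsZero-resp-≋ (≋-sym (f-⊕ p q)) (f-zero h) ⟩

⊗-congʳ : ∀ {p p′} q → p ≋ p′ → p ⊗ q ≋ p′ ⊗ q
⊗-congʳ q = additive-cong (_⊗ q) (λ p p′ → ⊗-distribʳ-⊕ p p′ q) (IsZero-⊗ˡ q)

⊗-congˡ : ∀ p {q q′} → q ≋ q′ → p ⊗ q ≋ p ⊗ q′
⊗-congˡ p = additive-cong (p ⊗_) (⊗-distribˡ-⊕ p) (IsZero-⊗ʳ p)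

⊗-assoc : ∀ p q s → (p ⊗ q) ⊗ s ≋ p ⊗ (q ⊗ s)
⊗-assoc []      q s = ≋-refl
⊗-assoc (a ∷ p) q s =
  ≋-trans (⊗-distribʳ-⊕ (a · q) (false ∷ p ⊗ q) s)
          (⊕-cong (≋-reflexive (·-⊗ a q s)) (∷-cong false (⊗-assoc p q s)))

⊗-identityˡ : ∀ p → one ⊗ p ≋ p
⊗-identityˡ p = ≋-trans (⊕-congˡ (IsZero⇒≋ (refl ∷ []) [])) (≋-reflexive (⊕-identityʳ p))

^-+ : ∀ p m n → p ^ m ⊗ p ^ n ≋ p ^ (m + n)
^-+ p zero    n = ⊗-identityˡ (p ^ n)
^-+ p (suc m) n = ≋-trans (⊗-assoc p (p ^ m) (p ^ n)) (⊗-congˡ p (^-+ p m n))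

module ≋-Reasoning = SetoidReasoning ≋-setoid

isZero? : (p : Poly) → Dec (IsZero p)
isZero? = all? (_≟ᴮ false)

IsZero-decide : ∀ {p} → True (isZero? p) → IsZero p
IsZero-decide {p} = toWitness {a? = isZero? p}

F⁴≋G⁴⊕GF : F ^ 4 ≋ G ^ 4 ⊕ G ⊗ F
F⁴≋G⁴⊕GF = ⟨ IsZero-decide _ ⟩

G⁴≋F⁴⊕FG : G ^ 4 ≋ F ^ 4 ⊕ F ⊗ G
G⁴≋F⁴⊕FG = ⟨ IsZero-decide _ ⟩

^-recurrence : ∀ p q → p ^ 4 ≋ q ^ 4 ⊕ q ⊗ p →
  ∀ n → p ^ (4 + n) ≋ q ^ 4 ⊗ p ^ n ⊕ q ⊗ p ^ suc n
^-recurrence p q p⁴≋ n = begin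
  p ^ (4 + n)                       ≈⟨ ^-+ p 4 n ⟨
  p ^ 4 ⊗ p ^ n                     ≈⟨ ⊗-congʳ (p ^ n) p⁴≋ ⟩
  (q ^ 4 ⊕ q ⊗ p) ⊗ p ^ n           ≈⟨ ⊗-distribʳ-⊕ (q ^ 4) (q ⊗ p) (p ^ n) ⟩
  q ^ 4 ⊗ p ^ n ⊕ (q ⊗ p) ⊗ p ^ n   ≈⟨ ⊕-congˡ (⊗-assoc q p (p ^ n)) ⟩
  q ^ 4 ⊗ p ^ n ⊕ q ⊗ p ^ suc n     ∎
  where open ≋-Reasoning

infixl 6 _⊕ᵈ_ _⊕ᴰ_

_⊕ᵈ_ : Digit → Digit → Digit
dig a b c d ⊕ᵈ dig a′ b′ c′ d′ = dig (a xor a′) (b xor b′) (c xor c′) (d xor d′)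

_⊕ᴰ_ : List Digit → List Digit → List Digit
[]       ⊕ᴰ ys       = ys
(x ∷ xs) ⊕ᴰ []       = x ∷ xs
(x ∷ xs) ⊕ᴰ (y ∷ ys) = x ⊕ᵈ y ∷ xs ⊕ᴰ ys

0ᵈ : Digit
0ᵈ = dig false false false false

constᴰ : Bool → List Digit
constᴰ a = dig a false false false ∷ []

-- Expansions are compared through this 𝔽₂-linear bijection onto coefficient
-- lists; it is not the evaluation Σ D_k G^k.
flat : List Digit → Poly
flat []                 = []
flat (dig a b c d ∷ xs) = a ∷ b ∷ c ∷ d ∷ flat xs

flat-⊕ᴰ : ∀ xs ys → flat (xs ⊕ᴰ ys) ≡ flat xs ⊕ flat ys
flat-⊕ᴰ []                 ys                 = refl
flat-⊕ᴰ (dig _ _ _ _ ∷ xs) []                 = refl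
flat-⊕ᴰ (dig _ _ _ _ ∷ xs) (dig _ _ _ _ ∷ ys) =
  cong (λ p → _ ∷ _ ∷ _ ∷ _ ∷ p) (flat-⊕ᴰ xs ys)

infix 4 _~_

record _~_ (xs ys : List Digit) : Set where
  constructor ⟪_⟫
  field ~⇒≋ : flat xs ≋ flat ys

open _~_

~-refl : ∀ {xs} → xs ~ xs
~-refl = ⟪ ≋-refl ⟫

~-reflexive : ∀ {xs ys} → xs ≡ ys → xs ~ ys
~-reflexive refl = ~-refl

~-sym : ∀ {xs ys} → xs ~ ys → ys ~ xs
~-sym ⟪ h ⟫ = ⟪ ≋-sym h ⟫

~-trans : ∀ {xs ys zs} → xs ~ ys → ys ~ zs → xs ~ zs
~-trans ⟪ h₁ ⟫ ⟪ h₂ ⟫ = ⟪ ≋-trans h₁ h₂ ⟫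

~-setoid : Setoid 0ℓ 0ℓ
~-setoid = record
  { Carrier       = List Digit
  ; _≈_           = _~_
  ; isEquivalence = record { refl = ~-refl ; sym = ~-sym ; trans = ~-trans }
  }

module ~-Reasoning = SetoidReasoning ~-setoid

⊕ᴰ-cong : ∀ {xs xs′ ys ys′} → xs ~ xs′ → ys ~ ys′ → xs ⊕ᴰ ys ~ xs′ ⊕ᴰ ys′
⊕ᴰ-cong {xs} {xs′} {ys} {ys′} ⟪ h₁ ⟫ ⟪ h₂ ⟫ =
  ⟪ subst₂ _≋_ (sym (flat-⊕ᴰ xs ys)) (sym (flat-⊕ᴰ xs′ ys′)) (⊕-cong h₁ h₂) ⟫

⊕ᴰ-congˡ : ∀ xs {ys ys′} → ys ~ ys′ → xs ⊕ᴰ ys ~ xs ⊕ᴰ ys′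
⊕ᴰ-congˡ xs = ⊕ᴰ-cong (~-refl {xs})

⊕ᴰ-interchange : ∀ ws xs ys zs → (ws ⊕ᴰ xs) ⊕ᴰ (ys ⊕ᴰ zs) ~ (ws ⊕ᴰ ys) ⊕ᴰ (xs ⊕ᴰ zs)
⊕ᴰ-interchange ws xs ys zs = ⟪ ≋-reflexive (begin
  flat ((ws ⊕ᴰ xs) ⊕ᴰ (ys ⊕ᴰ zs))            ≡⟨ flat-⊕ᴰ (ws ⊕ᴰ xs) (ys ⊕ᴰ zs) ⟩
  flat (ws ⊕ᴰ xs) ⊕ flat (ys ⊕ᴰ zs)          ≡⟨ cong₂ _⊕_ (flat-⊕ᴰ ws xs) (flat-⊕ᴰ ys zs) ⟩
  (flat ws ⊕ flat xs) ⊕ (flat ys ⊕ flat zs)  ≡⟨ ⊕-interchange (flat ws) (flat xs) (flat ys) (flat zs) ⟩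
  (flat ws ⊕ flat ys) ⊕ (flat xs ⊕ flat zs)  ≡⟨ cong₂ _⊕_ (flat-⊕ᴰ ws ys) (flat-⊕ᴰ xs zs) ⟨
  flat (ws ⊕ᴰ ys) ⊕ flat (xs ⊕ᴰ zs)          ≡⟨ flat-⊕ᴰ (ws ⊕ᴰ ys) (xs ⊕ᴰ zs) ⟨
  flat ((ws ⊕ᴰ ys) ⊕ᴰ (xs ⊕ᴰ zs))            ∎) ⟫
  where open ≡-Reasoning

∷-cong~ : ∀ d {xs ys} → xs ~ ys → d ∷ xs ~ d ∷ ys
∷-cong~ (dig a b c d) ⟪ h ⟫ = ⟪ ∷-cong a (∷-cong b (∷-cong c (∷-cong d h))) ⟫

⊕ᵈ-identityʳ : ∀ x → x ⊕ᵈ 0ᵈ ≡ x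
⊕ᵈ-identityʳ (dig a b c d)
  rewrite xor-identityʳ a | xor-identityʳ b | xor-identityʳ c | xor-identityʳ d = refl

⊕ᴰ-identityʳ : ∀ xs → xs ⊕ᴰ [] ≡ xs
⊕ᴰ-identityʳ []       = refl
⊕ᴰ-identityʳ (x ∷ xs) = refl

IsZeroᴰ : List Digit → Set
IsZeroᴰ xs = IsZero (flat xs)

IsZeroᴰ-⊕ᴰ : ∀ {xs ys} → xs ~ ys → IsZeroᴰ (xs ⊕ᴰ ys)
IsZeroᴰ-⊕ᴰ {xs} {ys} ⟪ ⟨ h ⟩ ⟫ = subst IsZero (sym (flat-⊕ᴰ xs ys)) h

~-from-IsZeroᴰ : ∀ {xs ys} → IsZeroᴰ (xs ⊕ᴰ ys) → xs ~ ys
~-from-IsZeroᴰ {xs} {ys} h = ⟪ ⟨ subst IsZero (flat-⊕ᴰ xs ys) h ⟩ ⟫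

IsZeroᴰ-resp-~ : ∀ {xs ys} → xs ~ ys → IsZeroᴰ ys → IsZeroᴰ xs
IsZeroᴰ-resp-~ h = IsZero-resp-≋ (~⇒≋ h)

mulR-⊕ᴰ : ∀ c c′ xs ys → mulR c xs ⊕ᴰ mulR c′ ys ~ mulR (c xor c′) (xs ⊕ᴰ ys)
mulR-⊕ᴰ false _     []                 _  = ~-refl
mulR-⊕ᴰ true  false []                 [] = ~-refl
mulR-⊕ᴰ true  true  []                 [] = ⟪ IsZero⇒≋ (refl ∷ refl ∷ refl ∷ refl ∷ []) [] ⟫
mulR-⊕ᴰ true  _     []                 (dig _ _ _ _ ∷ _) = ~-refl
mulR-⊕ᴰ c     false (dig _ _ _ _ ∷ _) [] rewrite xor-identityʳ c = ~-refl
mulR-⊕ᴰ c     true  (dig a b e d ∷ xs) []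
  rewrite xor-identityʳ a | xor-identityʳ b | xor-identityʳ (e xor d)
        | ⊕ᴰ-identityʳ (mulR d xs) = ~-refl
mulR-⊕ᴰ c     c′    (dig a b e d ∷ xs) (dig a′ b′ e′ d′ ∷ ys)
  rewrite xor-interchange e d e′ d′ = ∷-cong~ _ (mulR-⊕ᴰ d d′ xs ys)

mulR-IsZeroᴰ : ∀ {xs} → IsZeroᴰ xs → IsZeroᴰ (mulR false xs)
mulR-IsZeroᴰ {[]}               _                                = []
mulR-IsZeroᴰ {dig _ _ _ _ ∷ xs} (refl ∷ refl ∷ refl ∷ refl ∷ z) =
  refl ∷ refl ∷ refl ∷ refl ∷ mulR-IsZeroᴰ {xs} z

mulR-cong : ∀ {xs ys} → xs ~ ys → mulR false xs ~ mulR false ys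
mulR-cong {xs} {ys} h = ~-from-IsZeroᴰ
  (IsZeroᴰ-resp-~ (mulR-⊕ᴰ false false xs ys) (mulR-IsZeroᴰ (IsZeroᴰ-⊕ᴰ h)))

mulRⁿ : ℕ → List Digit → List Digit
mulRⁿ zero    xs = xs
mulRⁿ (suc k) xs = mulR false (mulRⁿ k xs)

mulRⁿ-cong : ∀ k {xs ys} → xs ~ ys → mulRⁿ k xs ~ mulRⁿ k ys
mulRⁿ-cong zero    h = h
mulRⁿ-cong (suc k) h = mulR-cong (mulRⁿ-cong k h)

mulRⁿ-⊕ᴰ : ∀ k xs ys → mulRⁿ k (xs ⊕ᴰ ys) ~ mulRⁿ k xs ⊕ᴰ mulRⁿ k ys
mulRⁿ-⊕ᴰ zero    xs ys = ~-refl
mulRⁿ-⊕ᴰ (suc k) xs ys = begin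
  mulR false (mulRⁿ k (xs ⊕ᴰ ys))                         ≈⟨ mulR-cong (mulRⁿ-⊕ᴰ k xs ys) ⟩
  mulR false (mulRⁿ k xs ⊕ᴰ mulRⁿ k ys)                   ≈⟨ mulR-⊕ᴰ false false (mulRⁿ k xs) (mulRⁿ k ys) ⟨
  mulR false (mulRⁿ k xs) ⊕ᴰ mulR false (mulRⁿ k ys)      ∎
  where open ~-Reasoning

mulRⁿ-0ᵈ∷ : ∀ k xs → mulRⁿ k (0ᵈ ∷ xs) ≡ 0ᵈ ∷ mulRⁿ k xs
mulRⁿ-0ᵈ∷ zero    xs = refl
mulRⁿ-0ᵈ∷ (suc k) xs = cong (mulR false) (mulRⁿ-0ᵈ∷ k xs)

G-shift-digit : ∀ x → mulRⁿ 3 (x ∷ []) ⊕ᴰ mulRⁿ 4 (x ∷ []) ~ 0ᵈ ∷ x ∷ []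
G-shift-digit (dig false false false false) = ⟪ ⟨ IsZero-decide _ ⟩ ⟫
G-shift-digit (dig false false false true ) = ⟪ ⟨ IsZero-decide _ ⟩ ⟫
G-shift-digit (dig false false true  false) = ⟪ ⟨ IsZero-decide _ ⟩ ⟫
G-shift-digit (dig false false true  true ) = ⟪ ⟨ IsZero-decide _ ⟩ ⟫
G-shift-digit (dig false true  false false) = ⟪ ⟨ IsZero-decide _ ⟩ ⟫
G-shift-digit (dig false true  false true ) = ⟪ ⟨ IsZero-decide _ ⟩ ⟫
G-shift-digit (dig false true  true  false) = ⟪ ⟨ IsZero-decide _ ⟩ ⟫
G-shift-digit (dig false true  true  true ) = ⟪ ⟨ IsZero-decide _ ⟩ ⟫
G-shift-digit (dig true  false false false) = ⟪ ⟨ IsZero-decide _ ⟩ ⟫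
G-shift-digit (dig true  false false true ) = ⟪ ⟨ IsZero-decide _ ⟩ ⟫
G-shift-digit (dig true  false true  false) = ⟪ ⟨ IsZero-decide _ ⟩ ⟫
G-shift-digit (dig true  false true  true ) = ⟪ ⟨ IsZero-decide _ ⟩ ⟫
G-shift-digit (dig true  true  false false) = ⟪ ⟨ IsZero-decide _ ⟩ ⟫
G-shift-digit (dig true  true  false true ) = ⟪ ⟨ IsZero-decide _ ⟩ ⟫
G-shift-digit (dig true  true  true  false) = ⟪ ⟨ IsZero-decide _ ⟩ ⟫
G-shift-digit (dig true  true  true  true ) = ⟪ ⟨ IsZero-decide _ ⟩ ⟫

∷-split : ∀ x xs → x ∷ xs ≡ (x ∷ []) ⊕ᴰ (0ᵈ ∷ xs)
∷-split x xs = cong (_∷ xs) (sym (⊕ᵈ-identityʳ x))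

-- r³ ⊕ r⁴ = G, and multiplying Σ D_k G^k by G shifts the digits.
G-shift : ∀ xs → mulRⁿ 3 xs ⊕ᴰ mulRⁿ 4 xs ~ 0ᵈ ∷ xs
G-shift []       = ⟪ IsZero⇒≋ [] (refl ∷ refl ∷ refl ∷ refl ∷ []) ⟫
G-shift (x ∷ xs) = begin
  mulRⁿ 3 (x ∷ xs) ⊕ᴰ mulRⁿ 4 (x ∷ xs)
    ≡⟨ cong (λ ys → mulRⁿ 3 ys ⊕ᴰ mulRⁿ 4 ys) (∷-split x xs) ⟩
  mulRⁿ 3 ([ x ] ⊕ᴰ (0ᵈ ∷ xs)) ⊕ᴰ mulRⁿ 4 ([ x ] ⊕ᴰ (0ᵈ ∷ xs))
    ≈⟨ ⊕ᴰ-cong (mulRⁿ-⊕ᴰ 3 [ x ] (0ᵈ ∷ xs)) (mulRⁿ-⊕ᴰ 4 [ x ] (0ᵈ ∷ xs)) ⟩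
  (mulRⁿ 3 [ x ] ⊕ᴰ mulRⁿ 3 (0ᵈ ∷ xs)) ⊕ᴰ (mulRⁿ 4 [ x ] ⊕ᴰ mulRⁿ 4 (0ᵈ ∷ xs))
    ≈⟨ ⊕ᴰ-interchange (mulRⁿ 3 [ x ]) _ (mulRⁿ 4 [ x ]) _ ⟩
  (mulRⁿ 3 [ x ] ⊕ᴰ mulRⁿ 4 [ x ]) ⊕ᴰ (mulRⁿ 3 (0ᵈ ∷ xs) ⊕ᴰ mulRⁿ 4 (0ᵈ ∷ xs))
    ≡⟨ cong₂ (λ ys zs → (mulRⁿ 3 [ x ] ⊕ᴰ mulRⁿ 4 [ x ]) ⊕ᴰ (ys ⊕ᴰ zs))
             (mulRⁿ-0ᵈ∷ 3 xs) (mulRⁿ-0ᵈ∷ 4 xs) ⟩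
  (mulRⁿ 3 [ x ] ⊕ᴰ mulRⁿ 4 [ x ]) ⊕ᴰ (0ᵈ ∷ mulRⁿ 3 xs ⊕ᴰ mulRⁿ 4 xs)
    ≈⟨ ⊕ᴰ-cong (G-shift-digit x) (∷-cong~ 0ᵈ (G-shift xs)) ⟩
  (0ᵈ ∷ [ x ]) ⊕ᴰ (0ᵈ ∷ 0ᵈ ∷ xs)
    ≡⟨ cong (0ᵈ ∷_) (∷-split x xs) ⟨
  0ᵈ ∷ x ∷ xs
    ∎
  where open ~-Reasoning

addConst≡constᴰ⊕ᴰ : ∀ a xs → addConst a xs ≡ constᴰ a ⊕ᴰ xs
addConst≡constᴰ⊕ᴰ a []                 = refl
addConst≡constᴰ⊕ᴰ a (dig _ _ _ _ ∷ _) = refl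

expand-∷ : ∀ a p → expand (a ∷ p) ≡ constᴰ a ⊕ᴰ mulR false (expand p)
expand-∷ a p = addConst≡constᴰ⊕ᴰ a (mulR false (expand p))

expand-⊕ : ∀ p q → expand (p ⊕ q) ~ expand p ⊕ᴰ expand q
expand-⊕ []      q       = ~-refl
expand-⊕ (a ∷ p) []      = ~-reflexive (sym (⊕ᴰ-identityʳ _))
expand-⊕ (a ∷ p) (b ∷ q) = begin
  expand ((a xor b) ∷ (p ⊕ q))
    ≡⟨ expand-∷ (a xor b) (p ⊕ q) ⟩
  constᴰ (a xor b) ⊕ᴰ mulR false (expand (p ⊕ q))
    ≈⟨ ⊕ᴰ-congˡ (constᴰ (a xor b)) (mulR-cong (expand-⊕ p q)) ⟩
  constᴰ (a xor b) ⊕ᴰ mulR false (expand p ⊕ᴰ expand q)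
    ≈⟨ ⊕ᴰ-congˡ (constᴰ (a xor b)) (mulR-⊕ᴰ false false (expand p) (expand q)) ⟨
  (constᴰ a ⊕ᴰ constᴰ b) ⊕ᴰ (mulR false (expand p) ⊕ᴰ mulR false (expand q))
    ≈⟨ ⊕ᴰ-interchange (constᴰ a) (constᴰ b) (mulR false (expand p)) _ ⟩
  (constᴰ a ⊕ᴰ mulR false (expand p)) ⊕ᴰ (constᴰ b ⊕ᴰ mulR false (expand q))
    ≡⟨ cong₂ _⊕ᴰ_ (expand-∷ a p) (expand-∷ b q) ⟨
  expand (a ∷ p) ⊕ᴰ expand (b ∷ q)
    ∎
  where open ~-Reasoning

expand-false∷ : ∀ p → expand (false ∷ p) ~ mulR false (expand p)
expand-false∷ p = begin
  expand (false ∷ p)                          ≡⟨ expand-∷ false p ⟩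
  constᴰ false ⊕ᴰ mulR false (expand p)       ≈⟨ ⊕ᴰ-cong constᴰ-false~[] ~-refl ⟩
  mulR false (expand p)                       ∎
  where
  open ~-Reasoning
  constᴰ-false~[] : constᴰ false ~ []
  constᴰ-false~[] = ⟪ IsZero⇒≋ (refl ∷ refl ∷ refl ∷ refl ∷ []) [] ⟫

expand-IsZero : ∀ {p} → IsZero p → IsZeroᴰ (expand p)
expand-IsZero {[]}        _          = []
expand-IsZero {false ∷ p} (refl ∷ z) =
  IsZeroᴰ-resp-~ (expand-false∷ p) (mulR-IsZeroᴰ (expand-IsZero z))

expand-cong : ∀ {p q} → p ≋ q → expand p ~ expand q
expand-cong {p} {q} ⟨ h ⟩ =
  ~-from-IsZeroᴰ (IsZeroᴰ-resp-~ (~-sym (expand-⊕ p q)) (expand-IsZero h))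

G⊗≋r³⊕r⁴ : ∀ p → G ⊗ p ≋ false ∷ false ∷ false ∷ (p ⊕ (false ∷ p))
G⊗≋r³⊕r⁴ p = ∷-cong false (∷-cong false (∷-cong false (⊕-congˡ (∷-cong false p⊕0≋p))))
  where
  p⊕0≋p : p ⊕ (false ∷ []) ≋ p
  p⊕0≋p = ≋-trans (≋-reflexive (⊕-comm p _)) (⊕-identityˡ-IsZero p (refl ∷ []))

expand-G⊗ : ∀ p → expand (G ⊗ p) ~ 0ᵈ ∷ expand p
expand-G⊗ p = begin
  expand (G ⊗ p)                              ≈⟨ expand-cong (G⊗≋r³⊕r⁴ p) ⟩
  expand (false ∷ false ∷ false ∷ q)          ≈⟨ expand-false∷ (false ∷ false ∷ q) ⟩
  mulRⁿ 1 (expand (false ∷ false ∷ q))        ≈⟨ mulRⁿ-cong 1 (expand-false∷ (false ∷ q)) ⟩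
  mulRⁿ 2 (expand (false ∷ q))                ≈⟨ mulRⁿ-cong 2 (expand-false∷ q) ⟩
  mulRⁿ 3 (expand q)                          ≈⟨ mulRⁿ-cong 3 (expand-⊕ p (false ∷ p)) ⟩
  mulRⁿ 3 (expand p ⊕ᴰ expand (false ∷ p))    ≈⟨ mulRⁿ-cong 3 (⊕ᴰ-congˡ (expand p) (expand-false∷ p)) ⟩
  mulRⁿ 3 (expand p ⊕ᴰ mulRⁿ 1 (expand p))    ≈⟨ mulRⁿ-⊕ᴰ 3 (expand p) (mulRⁿ 1 (expand p)) ⟩
  mulRⁿ 3 (expand p) ⊕ᴰ mulRⁿ 4 (expand p)    ≈⟨ G-shift (expand p) ⟩
  0ᵈ ∷ expand p                               ∎
  where
  open ~-Reasoning
  q : Poly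
  q = p ⊕ (false ∷ p)

Udig-⊕ᵈ : ∀ x y → Udig (x ⊕ᵈ y) ≡ Udig x ⊕ Udig y
Udig-⊕ᵈ (dig a b c d) (dig a′ b′ c′ d′) =
  cong₂ (λ u v → (a xor a′) ∷ u ∷ v ∷ (d xor d′) ∷ [])
        (xor-interchange b b′ d d′) (xor-interchange c c′ d d′)

Uexp-⊕ᴰ : ∀ xs ys → Uexp (xs ⊕ᴰ ys) ≋ Uexp xs ⊕ Uexp ys
Uexp-⊕ᴰ []       ys       = ≋-refl
Uexp-⊕ᴰ (x ∷ xs) []       = ≋-reflexive (sym (⊕-identityʳ _))
Uexp-⊕ᴰ (x ∷ xs) (y ∷ ys) = begin
  Udig (x ⊕ᵈ y) ⊕ F ⊗ Uexp (xs ⊕ᴰ ys)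
    ≈⟨ ⊕-cong (≋-reflexive (Udig-⊕ᵈ x y)) (⊗-congˡ F (Uexp-⊕ᴰ xs ys)) ⟩
  (Udig x ⊕ Udig y) ⊕ F ⊗ (Uexp xs ⊕ Uexp ys)
    ≈⟨ ⊕-congˡ (⊗-distribˡ-⊕ F (Uexp xs) (Uexp ys)) ⟩
  (Udig x ⊕ Udig y) ⊕ (F ⊗ Uexp xs ⊕ F ⊗ Uexp ys)
    ≡⟨ ⊕-interchange (Udig x) (Udig y) (F ⊗ Uexp xs) (F ⊗ Uexp ys) ⟩
  (Udig x ⊕ F ⊗ Uexp xs) ⊕ (Udig y ⊕ F ⊗ Uexp ys)
    ∎
  where open ≋-Reasoning

Uexp-IsZero : ∀ {xs} → IsZeroᴰ xs → IsZero (Uexp xs)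
Uexp-IsZero {[]}               _                                = []
Uexp-IsZero {dig _ _ _ _ ∷ xs} (refl ∷ refl ∷ refl ∷ refl ∷ z) =
  IsZero-⊕ (refl ∷ refl ∷ refl ∷ refl ∷ []) (IsZero-⊗ʳ F (Uexp-IsZero {xs} z))

Uexp-cong : ∀ {xs ys} → xs ~ ys → Uexp xs ≋ Uexp ys
Uexp-cong {xs} {ys} h = ⟨ IsZero-resp-≋ (≋-sym (Uexp-⊕ᴰ xs ys)) (Uexp-IsZero (IsZeroᴰ-⊕ᴰ h)) ⟩

U-⊕ : ∀ p q → U (p ⊕ q) ≋ U p ⊕ U q
U-⊕ p q = ≋-trans (Uexp-cong (expand-⊕ p q)) (Uexp-⊕ᴰ (expand p) (expand q))

U-cong : ∀ {p q} → p ≋ q → U p ≋ U q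
U-cong = additive-cong U U-⊕ (λ z → Uexp-IsZero (expand-IsZero z))

U-G⊗ : ∀ p → U (G ⊗ p) ≋ F ⊗ U p
U-G⊗ p = ≋-trans (Uexp-cong (expand-G⊗ p)) (⊕-identityˡ-IsZero (F ⊗ U p) (refl ∷ refl ∷ refl ∷ refl ∷ []))

U-G^⊗ : ∀ k p → U (G ^ k ⊗ p) ≋ F ^ k ⊗ U p
U-G^⊗ zero    p = ≋-trans (U-cong (⊗-identityˡ p)) (≋-sym (⊗-identityˡ (U p)))
U-G^⊗ (suc k) p = begin
  U ((G ⊗ G ^ k) ⊗ p)    ≈⟨ U-cong (⊗-assoc G (G ^ k) p) ⟩
  U (G ⊗ (G ^ k ⊗ p))    ≈⟨ U-G⊗ (G ^ k ⊗ p) ⟩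
  F ⊗ U (G ^ k ⊗ p)      ≈⟨ ⊗-congˡ F (U-G^⊗ k p) ⟩
  F ⊗ (F ^ k ⊗ U p)      ≈⟨ ⊗-assoc F (F ^ k) (U p) ⟨
  (F ⊗ F ^ k) ⊗ U p      ∎
  where open ≋-Reasoning

Recurrent : (ℕ → Poly) → Set
Recurrent P = ∀ n → P (4 + n) ≋ F ^ 4 ⊗ P n ⊕ F ⊗ P (suc n)

Recurrent-resp : ∀ P Q → (∀ n → P n ≋ Q n) → Recurrent Q → Recurrent P
Recurrent-resp P Q P≋Q rec n = begin
  P (4 + n)                        ≈⟨ P≋Q (4 + n) ⟩
  Q (4 + n)                        ≈⟨ rec n ⟩
  F ^ 4 ⊗ Q n ⊕ F ⊗ Q (suc n)      ≈⟨ ⊕-cong (⊗-congˡ (F ^ 4) (P≋Q n)) (⊗-congˡ F (P≋Q (suc n))) ⟨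
  F ^ 4 ⊗ P n ⊕ F ⊗ P (suc n)      ∎
  where open ≋-Reasoning

G^-recurrent : Recurrent (G ^_)
G^-recurrent = ^-recurrence G F G⁴≋F⁴⊕FG

UF^-recurrent : Recurrent (λ n → U (F ^ n))
UF^-recurrent n = begin
  U (F ^ (4 + n))                          ≈⟨ U-cong (^-recurrence F G F⁴≋G⁴⊕GF n) ⟩
  U (G ^ 4 ⊗ F ^ n ⊕ G ⊗ F ^ suc n)        ≈⟨ U-⊕ (G ^ 4 ⊗ F ^ n) (G ⊗ F ^ suc n) ⟩
  U (G ^ 4 ⊗ F ^ n) ⊕ U (G ⊗ F ^ suc n)    ≈⟨ ⊕-cong (U-G^⊗ 4 (F ^ n)) (U-G⊗ (F ^ suc n)) ⟩
  F ^ 4 ⊗ U (F ^ n) ⊕ F ⊗ U (F ^ suc n)    ∎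
  where open ≋-Reasoning

Recurrent⇒IsZero : ∀ P → Recurrent P → ∀ n → IsZero (P (4 + n) ⊕ F ^ 4 ⊗ P n ⊕ F ⊗ P (suc n))
Recurrent⇒IsZero P rec n = subst IsZero (sym (⊕-assoc (P (4 + n)) _ _)) (≋⇒≈ (rec n))

lemma2p2 : (P : ℕ → Poly) →
    ((∀ n → P n ≈ G ^ n) ⊎ (∀ n → P n ≈ U (F ^ n))) →
    ∀ n → IsZero (P (suc (suc (suc (suc n)))) ⊕ (F ^ 4) ⊗ P n ⊕ F ⊗ P (suc n))
lemma2p2 P (inj₁ P≈G^) =
  Recurrent⇒IsZero P (Recurrent-resp P (G ^_) (λ n → ⟨ P≈G^ n ⟩) G^-recurrent)
lemma2p2 P (inj₂ P≈UF^) =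
  Recurrent⇒IsZero P (Recurrent-resp P (λ n → U (F ^ n)) (λ n → ⟨ P≈UF^ n ⟩) UF^-recurrent)
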